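{- Let $G$ be a connected cubic vertex-transitive graph of girth $5$ which is uniformly cyclically $5$-edge-connected. If $G$ contains a rosette as a subgraph, then $G$ is isomorphic to the dodecahedron.
   Context: A cyclic edge-cut of a graph $G$ is a set $F\subseteq E(G)$ such that $G-F$ has at least two components containing cycles. A cubic graph is cyclically $5$-edge-connected if every cyclic edge-cut has at least $5$ edges, and it is uniformly cyclically $5$-edge-connected if it is cyclically $5$-edge-connected and every edge lies in some cyclic edge-cut of exactly $5$ edges. The dodecahedron is the cubic planar graph with $20$ vertices and twelve pentagonal faces. A rosette is the graph on $15$ vertices obtained from the dodecahedron by deleting the five vertices of one pentagonal face (a central pentagon surrounded by a ring of five pentagons). -}

module Defs where

open import Data.Nat using (ℕ; zero; suc; _≤_; _<_; _<ᵇ_; _≡ᵇ_; s≤s)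
open import Data.Nat.Properties using (_<?_)
open import Data.Bool using (Bool; true; false; _∧_; _∨_; not; if_then_else_)
open import Data.Fin using (Fin; toℕ; fromℕ<) renaming (zero to fzero)
open import Data.List using (List; []; _∷_; allFin; cartesianProduct)
open import Data.Bool.ListAction using (any)
open import Data.Product using (Σ; ∃; ∃-syntax; _×_; _,_)
open import Relation.Nullary using (¬_; yes; no)
open import Relation.Binary.PropositionalEquality using (_≡_)
open import Function.Definitions using (Injective)
open import Function.Bundles using (_↔_; Inverse)

Graph : ℕ → Set
Graph n = Fin n → Fin n → Bool

IsSimple : ∀ {n} → Graph n → Set
IsSimple {n} G = (∀ u v → G u v ≡ G v u) × (∀ u → G u u ≡ false)

count : ∀ {A : Set} → (A → Bool) → List A → ℕ
count p [] = 0
count p (x ∷ xs) = if p x then suc (count p xs) else count p xs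

degree : ∀ {n} → Graph n → Fin n → ℕ
degree {n} G u = count (G u) (allFin n)

Cubic : ∀ {n} → Graph n → Set
Cubic {n} G = ∀ (u : Fin n) → degree G u ≡ 3

data Reach {n} (H : Graph n) : Fin n → Fin n → Set where
  here : ∀ {u} → Reach H u u
  step : ∀ {u w v} → H u w ≡ true → Reach H w v → Reach H u v

Connected : ∀ {n} → Graph n → Set
Connected {n} G = ∀ (u v : Fin n) → Reach G u v

next : ∀ {k} → Fin k → Fin k
next {suc m} i with toℕ i <? m
... | yes p = fromℕ< (s≤s p)
... | no _  = fzero

record Cycle {n} (H : Graph n) (k : ℕ) : Set where
  field
    vs     : Fin k → Fin n
    len≥3  : 3 ≤ k
    inj    : Injective _≡_ _≡_ vs
    closed : ∀ i → H (vs i) (vs (next i)) ≡ true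

HasGirth : ∀ {n} → Graph n → ℕ → Set
HasGirth G g = Cycle G g × (∀ k → Cycle G k → g ≤ k)

EdgeSubset : ∀ {n} → Graph n → (Fin n → Fin n → Bool) → Set
EdgeSubset G F = (∀ u v → F u v ≡ F v u) × (∀ u v → F u v ≡ true → G u v ≡ true)

edgeCount : ∀ {n} → (Fin n → Fin n → Bool) → ℕ
edgeCount {n} F =
  count (λ { (u , v) → (toℕ u <ᵇ toℕ v) ∧ F u v }) (cartesianProduct (allFin n) (allFin n))

removeEdges : ∀ {n} → Graph n → (Fin n → Fin n → Bool) → Graph n
removeEdges G F u v = G u v ∧ not (F u v)

CyclicEdgeCut : ∀ {n} → Graph n → (Fin n → Fin n → Bool) → Set
CyclicEdgeCut G F =
  EdgeSubset G F ×
  Σ ℕ λ k₁ → Σ ℕ λ k₂ →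
  Σ (Cycle (removeEdges G F) k₁) λ C₁ → Σ (Cycle (removeEdges G F) k₂) λ C₂ →
  ∃ λ i → ∃ λ j →
  ¬ Reach (removeEdges G F) (Cycle.vs C₁ i) (Cycle.vs C₂ j)

CyclicallyKEdgeConnected : ∀ {n} → ℕ → Graph n → Set
CyclicallyKEdgeConnected k G = ∀ F → CyclicEdgeCut G F → k ≤ edgeCount F

UniformlyCyclically5EdgeConnected : ∀ {n} → Graph n → Set
UniformlyCyclically5EdgeConnected G =
  CyclicallyKEdgeConnected 5 G ×
  (∀ u v → G u v ≡ true →
     ∃ λ F → CyclicEdgeCut G F × edgeCount F ≡ 5 × F u v ≡ true)

VertexTransitive : ∀ {n} → Graph n → Set
VertexTransitive {n} G = ∀ (u v : Fin n) →
  Σ (Fin n ↔ Fin n) λ σ →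
    (∀ x y → G x y ≡ G (Inverse.to σ x) (Inverse.to σ y)) × Inverse.to σ u ≡ v

Isomorphic : ∀ {n m} → Graph n → Graph m → Set
Isomorphic {n} {m} G H = Σ (Fin n ↔ Fin m) λ φ →
  ∀ x y → G x y ≡ H (Inverse.to φ x) (Inverse.to φ y)

ContainsSubgraph : ∀ {n m} → Graph n → Graph m → Set
ContainsSubgraph {n} {m} G H = Σ (Fin m → Fin n) λ f →
  Injective _≡_ _≡_ f × (∀ a b → H a b ≡ true → G (f a) (f b) ≡ true)

fromEdges : ∀ {n} → List (ℕ × ℕ) → Graph n
fromEdges es u v = any (λ { (a , b) →
  ((a ≡ᵇ toℕ u) ∧ (b ≡ᵇ toℕ v)) ∨ ((a ≡ᵇ toℕ v) ∧ (b ≡ᵇ toℕ u)) }) es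

-- Dodecahedron: outer pentagon 0..4, middle 10-cycle 5..14, inner pentagon 15..19;
-- outer i ~ middle 5+2i, inner 15+j ~ middle 5+2j+1.
dodecahedronEdges : List (ℕ × ℕ)
dodecahedronEdges =
  (0 , 1) ∷ (1 , 2) ∷ (2 , 3) ∷ (3 , 4) ∷ (4 , 0) ∷
  (5 , 6) ∷ (6 , 7) ∷ (7 , 8) ∷ (8 , 9) ∷ (9 , 10) ∷
  (10 , 11) ∷ (11 , 12) ∷ (12 , 13) ∷ (13 , 14) ∷ (14 , 5) ∷
  (15 , 16) ∷ (16 , 17) ∷ (17 , 18) ∷ (18 , 19) ∷ (19 , 15) ∷
  (0 , 5) ∷ (1 , 7) ∷ (2 , 9) ∷ (3 , 11) ∷ (4 , 13) ∷
  (15 , 6) ∷ (16 , 8) ∷ (17 , 10) ∷ (18 , 12) ∷ (19 , 14) ∷ []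

dodecahedron : Graph 20
dodecahedron = fromEdges dodecahedronEdges

-- Rosette: the dodecahedron minus the outer pentagon {0..4}, relabelled
-- v ↦ v - 5: middle 10-cycle 0..9, central pentagon 10..14.
rosetteEdges : List (ℕ × ℕ)
rosetteEdges =
  (0 , 1) ∷ (1 , 2) ∷ (2 , 3) ∷ (3 , 4) ∷ (4 , 5) ∷
  (5 , 6) ∷ (6 , 7) ∷ (7 , 8) ∷ (8 , 9) ∷ (9 , 0) ∷
  (10 , 11) ∷ (11 , 12) ∷ (12 , 13) ∷ (13 , 14) ∷ (14 , 10) ∷
  (10 , 1) ∷ (11 , 3) ∷ (12 , 5) ∷ (13 , 7) ∷ (14 , 9) ∷ []

rosette : Graph 15
rosette = fromEdges rosetteEdges

-- Vertex-transitivity moves the centre of the given rosette to any vertex, so every vertex has its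
-- neighbourhood inside a rosette: any two neighbours of a vertex lie on a pentagon through it.
-- Each of the five degree-two rim vertices 0, 2, 4, 6, 8 of the rosette has a third neighbour,
-- which cannot lie in the rosette (by girth 5, the saturation of the other vertices and the
-- pentagon property). Closing the pentagon through the third neighbour of rim vertex 0 and rim
-- vertices 1, 2 shows that consecutive third neighbours are adjacent, and a cubic degree count
-- shows they are distinct. So G contains a dodecahedron; its vertices are saturated, hence it is
-- closed under neighbours, and by connectivity it is all of G.
module Submission where

open import Defs
open import Data.Nat using (ℕ; zero; suc; _≤_; _<_; z≤n; s≤s) renaming (_≟_ to _≟ℕ_)
open import Data.Nat.Properties using (≤-trans; m≤n⇒m≤1+n; <-irrefl)
open import Data.Bool using (Bool; true; false; _∧_; not)
open import Data.Bool.Properties using (∧-zeroʳ) renaming (_≟_ to _≟ᵇ_)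
open import Data.Fin using (Fin; #_; _≟_; toℕ; splitAt) renaming (zero to fzero; suc to fsuc)
open import Data.Fin.Properties using (all?; any?; +↔⊎)
open import Data.List using (List; []; _∷_; length; filter; allFin)
open import Data.Vec using (lookup; []; _∷_)
open import Data.List.Relation.Unary.All using (All; []; _∷_)
import Data.List.Relation.Unary.All as All
open import Data.List.Relation.Unary.All.Properties using (all-filter)
open import Data.List.Relation.Unary.Any using (Any; here; there)
import Data.List.Relation.Unary.Any as Any
open import Data.List.Relation.Unary.AllPairs using ([]; _∷_)
open import Data.List.Relation.Unary.Unique.Propositional using (Unique)
open import Data.List.Relation.Unary.Unique.Propositional.Properties using (allFin⁺; filter⁺)
open import Data.List.Membership.Propositional using (_∈_)
open import Data.List.Membership.Propositional.Properties using (∈-allFin; ∈-filter⁻)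
open import Data.Product using (Σ; ∃; ∃₂; _×_; _,_; proj₁; proj₂)
open import Data.Empty using (⊥)
open import Data.Sum using (_⊎_; inj₁; inj₂; [_,_]′)
open import Function using (_∘_)
open import Function.Bundles using (_↔_; Inverse; Injection; mk↔ₛ′)
open import Function.Definitions using (Injective)
open import Function.Properties.Inverse using (↔⇒↣)
open import Relation.Nullary using (¬_; Dec; yes; no; does; contradiction)
open import Relation.Nullary.Decidable using (True; toWitness; dec-true; dec-false; _×-dec_; _⊎-dec_; _→-dec_; ¬?)
open import Relation.Binary.PropositionalEquality using (_≡_; _≢_; refl; sym; trans; cong; cong₂; subst)
open Relation.Binary.PropositionalEquality.≡-Reasoning

decide : ∀ {P : Set} (P? : Dec P) → {True P?} → P
decide _ {t} = toWitness t

Edge : ∀ {n} → Graph n → Fin n → Fin n → Set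
Edge G u v = G u v ≡ true

Edge? : ∀ {m} (H : Graph m) j k → Dec (Edge H j k)
Edge? H j k = H j k ≟ᵇ true

∧-true-left : ∀ {x y} → x ∧ y ≡ true → x ≡ true
∧-true-left {true} _ = refl

count-mono : ∀ {A : Set} {p q : A → Bool} → (∀ {x} → q x ≡ true → p x ≡ true) →
  ∀ xs → count q xs ≤ count p xs
count-mono q⇒p [] = z≤n
count-mono {p = p} {q} q⇒p (x ∷ xs) with p x in px | q x in qx
... | true  | true  = s≤s (count-mono q⇒p xs)
... | true  | false = m≤n⇒m≤1+n (count-mono q⇒p xs)
... | false | false = count-mono q⇒p xs
... | false | true  with () ← trans (sym (q⇒p qx)) px

count-< : ∀ {A : Set} {p q : A → Bool} → (∀ {x} → q x ≡ true → p x ≡ true) →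
  ∀ {x xs} → x ∈ xs → p x ≡ true → q x ≡ false → count q xs < count p xs
count-< q⇒p {xs = _ ∷ xs} (here refl) px qx rewrite px | qx = s≤s (count-mono q⇒p xs)
count-< {p = p} {q} q⇒p {xs = y ∷ _} (there x∈xs) px qx with p y in py | q y in qy
... | true  | true  = s≤s (count-< q⇒p x∈xs px qx)
... | true  | false = m≤n⇒m≤1+n (count-< q⇒p x∈xs px qx)
... | false | false = count-< q⇒p x∈xs px qx
... | false | true  with () ← trans (sym (q⇒p qy)) py

_∖_ : ∀ {n} → (Fin n → Bool) → Fin n → Fin n → Bool
(p ∖ a) x = p x ∧ not (does (x ≟ a))

Unique⇒length≤count : ∀ {n} (p : Fin n → Bool) {xs} → Unique xs → All (λ x → p x ≡ true) xs →
  length xs ≤ count p (allFin n)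
Unique⇒length≤count p [] [] = z≤n
Unique⇒length≤count p {a ∷ _} (a∉xs ∷ unique) (pa ∷ ps) =
  ≤-trans (s≤s (Unique⇒length≤count (p ∖ a) unique (All.zipWith kept (ps , a∉xs))))
          (count-< ∧-true-left (∈-allFin a) pa removed)
  where
  kept : ∀ {x} → p x ≡ true × a ≢ x → (p ∖ a) x ≡ true
  kept {x} (px , a≢x) rewrite px | dec-false (x ≟ a) (a≢x ∘ sym) = refl
  removed : (p ∖ a) a ≡ false
  removed rewrite dec-true (a ≟ a) refl = ∧-zeroʳ (p a)

avoid-two : ∀ {n} {P : Fin n → Set} {a b c} → P a → P b → P c → a ≢ b → a ≢ c → b ≢ c →
  ∀ x y → ∃ λ z → P z × z ≢ x × z ≢ y
avoid-two {a = a} {b} {c} pa pb pc a≢b a≢c b≢c x y with a ≟ x | a ≟ y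
... | no a≢x | no a≢y = a , pa , a≢x , a≢y
... | yes refl | _ with b ≟ y
...   | no b≢y   = b , pb , a≢b ∘ sym , b≢y
...   | yes refl = c , pc , a≢c ∘ sym , b≢c ∘ sym
avoid-two {a = a} {b} {c} pa pb pc a≢b a≢c b≢c x y | no _ | yes refl with b ≟ x
...   | no b≢x   = b , pb , b≢x , a≢b ∘ sym
...   | yes refl = c , pc , b≢c ∘ sym , a≢c ∘ sym

module _ {n} {G : Graph n} (simple : IsSimple G) where

  edge-sym : ∀ {u v} → Edge G u v → Edge G v u
  edge-sym {u} {v} uv = trans (proj₁ simple v u) uv

  edge⇒≢ : ∀ {u v} → Edge G u v → u ≢ v
  edge⇒≢ {u} uu refl with () ← trans (sym uu) (proj₂ simple u)

  no-triangle : HasGirth G 5 → ∀ {a b c} → Edge G a b → Edge G b c → Edge G c a → ⊥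
  no-triangle (_ , shortest) {a} {b} {c} ab bc ca =
    contradiction (shortest 3 triangle) λ { (s≤s (s≤s (s≤s ()))) }
    where
    vs : Fin 3 → Fin n
    vs fzero = a
    vs (fsuc fzero) = b
    vs (fsuc (fsuc fzero)) = c
    injective : Injective _≡_ _≡_ vs
    injective {fzero}               {fzero}               _ = refl
    injective {fzero}               {fsuc fzero}          e = contradiction e (edge⇒≢ ab)
    injective {fzero}               {fsuc (fsuc fzero)}   e = contradiction (sym e) (edge⇒≢ ca)
    injective {fsuc fzero}          {fzero}               e = contradiction (sym e) (edge⇒≢ ab)
    injective {fsuc fzero}          {fsuc fzero}          _ = refl
    injective {fsuc fzero}          {fsuc (fsuc fzero)}   e = contradiction e (edge⇒≢ bc)
    injective {fsuc (fsuc fzero)}   {fzero}               e = contradiction e (edge⇒≢ ca)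
    injective {fsuc (fsuc fzero)}   {fsuc fzero}          e = contradiction (sym e) (edge⇒≢ bc)
    injective {fsuc (fsuc fzero)}   {fsuc (fsuc fzero)}   _ = refl
    triangle : Cycle G 3
    triangle = record
      { vs = vs ; len≥3 = s≤s (s≤s (s≤s z≤n)) ; inj = injective
      ; closed = λ { fzero → ab ; (fsuc fzero) → bc ; (fsuc (fsuc fzero)) → ca } }

cubic-neighbours : ∀ {n} {G : Graph n} → Cubic G → ∀ {v a b c x} →
  Edge G v a → Edge G v b → Edge G v c → a ≢ b → a ≢ c → b ≢ c →
  Edge G v x → x ≡ a ⊎ x ≡ b ⊎ x ≡ c
cubic-neighbours {G = G} cubic {v} {a} {b} {c} {x} va vb vc a≢b a≢c b≢c vx with x ≟ a | x ≟ b | x ≟ c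
... | yes x≡a | _       | _       = inj₁ x≡a
... | no _    | yes x≡b | _       = inj₂ (inj₁ x≡b)
... | no _    | no _    | yes x≡c = inj₂ (inj₂ x≡c)
... | no x≢a  | no x≢b  | no x≢c  = contradiction (subst (4 ≤_) (cubic v) four≤degree) (<-irrefl refl)
  where
  four≤degree : 4 ≤ degree G v
  four≤degree = Unique⇒length≤count (G v)
    ((a≢b ∷ a≢c ∷ x≢a ∘ sym ∷ []) ∷ (b≢c ∷ x≢b ∘ sym ∷ []) ∷ (x≢c ∘ sym ∷ []) ∷ [] ∷ [])
    (va ∷ vb ∷ vc ∷ vx ∷ [])

record Embedding {m n} (H : Graph m) (G : Graph n) : Set where
  field
    to              : Fin m → Fin n
    injective       : Injective _≡_ _≡_ to
    edge-preserving : ∀ {a b} → Edge H a b → Edge G (to a) (to b)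

  to-≢ : ∀ {a b} → a ≢ b → to a ≢ to b
  to-≢ a≢b = a≢b ∘ injective

open Embedding

idₑ : ∀ {m} {H : Graph m} → Embedding H H
idₑ = record { to = λ a → a ; injective = λ e → e ; edge-preserving = λ e → e }

_∘ₑ_ : ∀ {l m n} {H : Graph l} {K : Graph m} {G : Graph n} →
  Embedding K G → Embedding H K → Embedding H G
F ∘ₑ E = record
  { to              = to F ∘ to E
  ; injective       = injective E ∘ injective F
  ; edge-preserving = edge-preserving F ∘ edge-preserving E
  }

automorphism : ∀ {n} {G : Graph n} (σ : Fin n ↔ Fin n) →
  (∀ x y → G x y ≡ G (Inverse.to σ x) (Inverse.to σ y)) → Embedding G G
automorphism {G = G} σ σ-edge = record
  { to              = Inverse.to σ
  ; injective       = Injection.injective (↔⇒↣ σ)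
  ; edge-preserving = λ {a} {b} ab → trans (sym (σ-edge a b)) ab
  }

embedding-at : ∀ {m n} {H : Graph m} {G : Graph n} → VertexTransitive G →
  Embedding H G → ∀ j v → Σ (Embedding H G) λ E → to E j ≡ v
embedding-at vt E j v with σ , σ-edge , σj≡v ← vt (to E j) v = automorphism σ σ-edge ∘ₑ E , σj≡v

neighbours : ∀ {m} → Graph m → Fin m → List (Fin m)
neighbours H j = filter (λ k → H j k ≟ᵇ true) (allFin _)

-- j is saturated in H when H already contains all three edges a cubic host graph can have at j.
Saturated : ∀ {m} → Graph m → Fin m → Set
Saturated H j = length (neighbours H j) ≡ 3

saturated? : ∀ {m} (H : Graph m) j → Dec (Saturated H j)
saturated? H j = length (neighbours H j) ≟ℕ 3

CommonNeighbour : ∀ {m} → Graph m → Fin m → Fin m → Set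
CommonNeighbour H j l = ∃ λ k → Edge H j k × Edge H l k

commonNeighbour? : ∀ {m} (H : Graph m) j l → Dec (CommonNeighbour H j l)
commonNeighbour? H j l = any? λ k → Edge? H j k ×-dec Edge? H l k

module _ {m n} {H : Graph m} {G : Graph n} (cubic : Cubic G) (E : Embedding H G) where

  saturated-neighbour : ∀ {j w} → Saturated H j → Edge G (to E j) w →
    Any (λ k → w ≡ to E k) (neighbours H j)
  saturated-neighbour {j} saturated =
    three (neighbours H j) saturated (filter⁺ _ (allFin⁺ m)) (all-filter _ (allFin m))
    where
    three : ∀ {w} ks → length ks ≡ 3 → Unique ks → All (Edge H j) ks →
      Edge G (to E j) w → Any (λ k → w ≡ to E k) ks
    three (a ∷ b ∷ c ∷ []) _ ((a≢b ∷ a≢c ∷ []) ∷ (b≢c ∷ []) ∷ _) (ja ∷ jb ∷ jc ∷ []) jw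
      with cubic-neighbours cubic (edge-preserving E ja) (edge-preserving E jb) (edge-preserving E jc)
             (to-≢ E a≢b) (to-≢ E a≢c) (to-≢ E b≢c) jw
    ... | inj₁ w≡a        = here w≡a
    ... | inj₂ (inj₁ w≡b) = there (here w≡b)
    ... | inj₂ (inj₂ w≡c) = there (there (here w≡c))

  saturated-reflects : ∀ {j k} → Saturated H j → Edge G (to E j) (to E k) → Edge H j k
  saturated-reflects {j} saturated jk =
    proj₂ (∈-filter⁻ (λ k → H j k ≟ᵇ true) {xs = allFin m}
            (Any.map (injective E) (saturated-neighbour saturated jk)))

  saturated-common-neighbour : ∀ {j l z} → Saturated H j → Saturated H l →
    Edge G (to E j) z → Edge G (to E l) z → ∃ λ k → Edge H j k × Edge H l k
  saturated-common-neighbour sj sl jz lz with k , refl ← Any.satisfied (saturated-neighbour sj jz) =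
    k , saturated-reflects sj jz , saturated-reflects sl lz

embedding⇒isomorphic : ∀ {m n} {H : Graph (suc m)} {G : Graph n} → Cubic G → Connected G →
  (∀ a → Saturated H a) → Embedding H G → Isomorphic G H
embedding⇒isomorphic {m} {n} {H} {G} cubic connected saturated E =
  mk↔ₛ′ from (to E) from-to to-from , λ x y → begin
    G x y                             ≡⟨ cong₂ G (sym (to-from x)) (sym (to-from y)) ⟩
    G (to E (from x)) (to E (from y)) ≡⟨ edge-image (from x) (from y) ⟩
    H (from x) (from y)               ∎
  where
  -- every vertex of H is saturated, so the image of E is closed under taking neighbours
  reach-image : ∀ {u w} → Reach G u w → ∃ (λ a → to E a ≡ u) → ∃ λ a → to E a ≡ w
  reach-image here image = image
  reach-image (step uv vw) (a , refl)
    with k , refl ← Any.satisfied (saturated-neighbour cubic E (saturated a) uv) = reach-image vw (k , refl)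

  preimage : ∀ w → ∃ λ a → to E a ≡ w
  preimage w = reach-image (connected (to E fzero) w) (fzero , refl)

  from : Fin n → Fin (suc m)
  from = proj₁ ∘ preimage

  to-from : ∀ w → to E (from w) ≡ w
  to-from = proj₂ ∘ preimage

  from-to : ∀ a → from (to E a) ≡ a
  from-to a = injective E (to-from (to E a))

  edge-image : ∀ a b → G (to E a) (to E b) ≡ H a b
  edge-image a b with H a b in ab
  ... | true = edge-preserving E ab
  ... | false with G (to E a) (to E b) in image-ab
  ...   | false = refl
  ...   | true  = trans (sym (saturated-reflects cubic E (saturated a) image-ab)) ab

rotate : Fin 15 → Fin 15
rotate = lookup (# 2 ∷ # 3 ∷ # 4 ∷ # 5 ∷ # 6 ∷ # 7 ∷ # 8 ∷ # 9 ∷ # 0 ∷ # 1 ∷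
                 # 11 ∷ # 12 ∷ # 13 ∷ # 14 ∷ # 10 ∷ [])

reflect : Fin 15 → Fin 15
reflect = lookup (# 0 ∷ # 9 ∷ # 8 ∷ # 7 ∷ # 6 ∷ # 5 ∷ # 4 ∷ # 3 ∷ # 2 ∷ # 1 ∷
                  # 14 ∷ # 13 ∷ # 12 ∷ # 11 ∷ # 10 ∷ [])

rosette-symmetry : (t : Fin 15 → Fin 15) →
  {True (all? λ a → all? λ b → (t a ≟ t b) →-dec (a ≟ b))} →
  {True (all? λ a → all? λ b → Edge? rosette a b →-dec Edge? rosette (t a) (t b))} →
  Embedding rosette rosette
rosette-symmetry t {injective} {edge-preserving} = record
  { to              = t
  ; injective       = λ {a} {b} → toWitness injective a b
  ; edge-preserving = λ {a} {b} → toWitness edge-preserving a b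
  }

rotationₑ reflectionₑ : Embedding rosette rosette
rotationₑ   = rosette-symmetry rotate
reflectionₑ = rosette-symmetry reflect

rotation : ℕ → Embedding rosette rosette
rotation zero    = idₑ
rotation (suc k) = rotation k ∘ₑ rotationₑ

rotation-surjective : ∀ k j → ∃ λ i → to (rotation k) i ≡ j
rotation-surjective zero    j = j , refl
rotation-surjective (suc k) j
  with i , refl ← rotation-surjective k j
  with i′ , refl ← decide (all? λ j → any? λ i → rotate i ≟ j) i = i′ , refl

rosette-unsaturated : ∀ j → ¬ Saturated rosette j → j ∈ (# 0 ∷ # 2 ∷ # 4 ∷ # 6 ∷ # 8 ∷ [])
rosette-unsaturated = decide (all? λ j → ¬? (saturated? rosette j) →-dec Any.any? (j ≟_) _)

rosette-neighbours-0 : ∀ j → Edge rosette j (# 0) → j ≡ # 1 ⊎ j ≡ # 9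
rosette-neighbours-0 = decide (all? λ j → Edge? rosette j (# 0) →-dec (j ≟ # 1 ⊎-dec j ≟ # 9))

spoke : Fin 5 → Fin 15
spoke k = to (rotation (toℕ k)) (# 0)

-- The dodecahedron as a rosette capped by a pentagon, pentagon vertex k being joined to rim
-- vertex spoke k = 2k; splitAt 5 reads off this decomposition from the labelling in Defs.
CappedEdge : Fin 5 ⊎ Fin 15 → Fin 5 ⊎ Fin 15 → Set
CappedEdge (inj₁ k) (inj₁ l) = l ≡ next k ⊎ k ≡ next l
CappedEdge (inj₁ k) (inj₂ j) = j ≡ spoke k
CappedEdge (inj₂ j) (inj₁ k) = j ≡ spoke k
CappedEdge (inj₂ i) (inj₂ j) = Edge rosette i j

cappedEdge? : ∀ c d → Dec (CappedEdge c d)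
cappedEdge? (inj₁ k) (inj₁ l) = l ≟ next k ⊎-dec k ≟ next l
cappedEdge? (inj₁ k) (inj₂ j) = j ≟ spoke k
cappedEdge? (inj₂ j) (inj₁ k) = j ≟ spoke k
cappedEdge? (inj₂ i) (inj₂ j) = Edge? rosette i j

dodecahedron-capped : ∀ a b → Edge dodecahedron a b → CappedEdge (splitAt 5 a) (splitAt 5 b)
dodecahedron-capped = decide (all? λ a → all? λ b →
  Edge? dodecahedron a b →-dec cappedEdge? (splitAt 5 a) (splitAt 5 b))

dodecahedron-saturated : ∀ a → Saturated dodecahedron a
dodecahedron-saturated = decide (all? (saturated? dodecahedron))

pentagon-pairs : ∀ (i j : Fin 5) →
  i ≡ j ⊎ j ≡ next i ⊎ i ≡ next j ⊎ j ≡ next (next i) ⊎ i ≡ next (next j)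
pentagon-pairs = decide (all? λ i → all? λ j →
  i ≟ j ⊎-dec j ≟ next i ⊎-dec i ≟ next j ⊎-dec j ≟ next (next i) ⊎-dec i ≟ next (next j))

injective-on-pentagon : ∀ {A : Set} (c : Fin 5 → A) → (∀ i → c i ≢ c (next i)) →
  (∀ i → c i ≢ c (next (next i))) → Injective _≡_ _≡_ c
injective-on-pentagon c near far {i} {j} ci≡cj with pentagon-pairs i j
... | inj₁ i≡j                       = i≡j
... | inj₂ (inj₁ refl)               = contradiction ci≡cj (near i)
... | inj₂ (inj₂ (inj₁ refl))        = contradiction (sym ci≡cj) (near j)
... | inj₂ (inj₂ (inj₂ (inj₁ refl))) = contradiction ci≡cj (far i)
... | inj₂ (inj₂ (inj₂ (inj₂ refl))) = contradiction (sym ci≡cj) (far j)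

module _ {n} {G : Graph n} (simple : IsSimple G) (cubic : Cubic G) (girth : HasGirth G 5)
         (vt : VertexTransitive G) (E₀ : Embedding rosette G) where

  ClosesToPentagon : Fin n → Fin n → Fin n → Set
  ClosesToPentagon a v b = ∃₂ λ y z → Edge G a y × Edge G y z × Edge G z b × y ≢ v × z ≢ v

  rosette-path : ∀ (E : Embedding rosette G) {j k l} p q → Edge rosette k p → Edge rosette p q →
    Edge rosette q l → p ≢ j → q ≢ j → ClosesToPentagon (to E k) (to E j) (to E l)
  rosette-path E p q kp pq ql p≢j q≢j =
    to E p , to E q , edge-preserving E kp , edge-preserving E pq , edge-preserving E ql ,
    to-≢ E p≢j , to-≢ E q≢j

  pentagon-at-centre : ∀ (E : Embedding rosette G) {a b} → a ≢ b →
    Any (λ k → a ≡ to E k) (neighbours rosette (# 10)) →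
    Any (λ l → b ≡ to E l) (neighbours rosette (# 10)) → ClosesToPentagon a (to E (# 10)) b
  pentagon-at-centre E a≢b (here refl) (here refl) = contradiction refl a≢b
  pentagon-at-centre E a≢b (here refl) (there (here refl)) =
    rosette-path E (# 2) (# 3) refl refl refl (λ ()) (λ ())
  pentagon-at-centre E a≢b (here refl) (there (there (here refl))) =
    rosette-path E (# 0) (# 9) refl refl refl (λ ()) (λ ())
  pentagon-at-centre E a≢b (there (here refl)) (here refl) =
    rosette-path E (# 3) (# 2) refl refl refl (λ ()) (λ ())
  pentagon-at-centre E a≢b (there (here refl)) (there (here refl)) = contradiction refl a≢b
  pentagon-at-centre E a≢b (there (here refl)) (there (there (here refl))) =
    rosette-path E (# 12) (# 13) refl refl refl (λ ()) (λ ())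
  pentagon-at-centre E a≢b (there (there (here refl))) (here refl) =
    rosette-path E (# 9) (# 0) refl refl refl (λ ()) (λ ())
  pentagon-at-centre E a≢b (there (there (here refl))) (there (here refl)) =
    rosette-path E (# 13) (# 12) refl refl refl (λ ()) (λ ())
  pentagon-at-centre E a≢b (there (there (here refl))) (there (there (here refl))) =
    contradiction refl a≢b

  pentagon : ∀ {v a b} → Edge G v a → Edge G v b → a ≢ b → ClosesToPentagon a v b
  pentagon {v} va vb a≢b with E , refl ← embedding-at vt E₀ (# 10) v =
    pentagon-at-centre E a≢b (saturated-neighbour cubic E refl va) (saturated-neighbour cubic E refl vb)

  other-neighbour : ∀ v x y → ∃ λ z → Edge G v z × z ≢ x × z ≢ y
  other-neighbour v with E , refl ← embedding-at vt E₀ (# 10) v =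
    avoid-two (edge-preserving E {# 10} {# 1} refl) (edge-preserving E {# 10} {# 11} refl)
              (edge-preserving E {# 10} {# 14} refl) (to-≢ E λ ()) (to-≢ E λ ()) (to-≢ E λ ())

  -- rim vertex 0 has degree two in the rosette; x is its third neighbour in G
  ThirdNeighbour : Embedding rosette G → Fin n → Set
  ThirdNeighbour E x = Edge G (to E (# 0)) x × x ≢ to E (# 1) × x ≢ to E (# 9)

  -- For x = 4 the pentagon through 4, 0 and 9 would need a common neighbour of 9 and of 3 or 5.
  third-neighbour≢4 : ∀ E {x} → ThirdNeighbour E x → x ≢ to E (# 4)
  third-neighbour≢4 E (0x , _ , _) refl
    with y , z , 4y , yz , z9 , y≢0 , _ ← pentagon 0x (edge-preserving E {# 0} {# 9} refl) (to-≢ E λ ())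
    with cubic-neighbours cubic (edge-preserving E {# 4} {# 3} refl) (edge-preserving E {# 4} {# 5} refl)
           (edge-sym simple 0x) (to-≢ E λ ()) (to-≢ E λ ()) (to-≢ E λ ()) 4y
  ... | inj₁ refl =
    decide (¬? (commonNeighbour? rosette (# 3) (# 9)))
      (saturated-common-neighbour cubic E refl refl yz (edge-sym simple z9))
  ... | inj₂ (inj₁ refl) =
    decide (¬? (commonNeighbour? rosette (# 5) (# 9)))
      (saturated-common-neighbour cubic E refl refl yz (edge-sym simple z9))
  ... | inj₂ (inj₂ refl) = y≢0 refl

  third-neighbour-∉-image : ∀ E {x} → ThirdNeighbour E x → ∀ j → x ≢ to E j
  third-neighbour-∉-image E third@(0x , x≢1 , x≢9) j refl with saturated? rosette j
  ... | yes saturated =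
    [ x≢1 ∘ cong (to E) , x≢9 ∘ cong (to E) ]′
      (rosette-neighbours-0 j (saturated-reflects cubic E saturated (edge-sym simple 0x)))
  ... | no unsaturated with rosette-unsaturated j unsaturated
  ...   | here refl = edge⇒≢ simple 0x refl
  ...   | there (here refl) =
    no-triangle simple girth (edge-preserving E {# 0} {# 1} refl) (edge-preserving E {# 1} {# 2} refl)
      (edge-sym simple 0x)
  ...   | there (there (here refl)) = third-neighbour≢4 E third refl
  ...   | there (there (there (here refl))) = third-neighbour≢4 (E ∘ₑ reflectionₑ) (0x , x≢9 , x≢1) refl
  ...   | there (there (there (there (here refl)))) =
    no-triangle simple girth (edge-preserving E {# 0} {# 9} refl) (edge-preserving E {# 9} {# 8} refl)
      (edge-sym simple 0x)

  third-neighbour-off-saturated : ∀ E {x} → ThirdNeighbour E x → ∀ {k} → Saturated rosette k →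
    ¬ Edge G x (to E k)
  third-neighbour-off-saturated E third saturated xk
    with l , refl ← Any.satisfied (saturated-neighbour cubic E saturated (edge-sym simple xk)) =
    third-neighbour-∉-image E third l refl

  third-neighbour-off-centre : ∀ E {x w} → ThirdNeighbour E x → Edge G x w → ¬ Edge G w (to E (# 10))
  third-neighbour-off-centre E third xw w10 with saturated-neighbour cubic E refl (edge-sym simple w10)
  ... | here refl                 = third-neighbour-off-saturated E third {# 1} refl xw
  ... | there (here refl)         = third-neighbour-off-saturated E third {# 11} refl xw
  ... | there (there (here refl)) = third-neighbour-off-saturated E third {# 14} refl xw

  -- The pentagon through x, rim vertex 0 and rim vertex 1 must return through rim vertex 2, whose
  -- only neighbour off the rosette is y.
  third-neighbours-adjacent : ∀ E {x y} → ThirdNeighbour E x → ThirdNeighbour (E ∘ₑ rotationₑ) y →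
    Edge G x y
  third-neighbours-adjacent E third@(0x , x≢1 , _) (2y , y≢3 , y≢1)
    with w , z , xw , wz , z1 , _ , z≢0 ← pentagon 0x (edge-preserving E {# 0} {# 1} refl) x≢1
    with saturated-neighbour cubic E refl (edge-sym simple z1)
  ... | here refl                 = contradiction refl z≢0
  ... | there (there (here refl)) = contradiction wz (third-neighbour-off-centre E third xw)
  ... | there (here refl)
    with cubic-neighbours cubic (edge-preserving E {# 2} {# 1} refl) (edge-preserving E {# 2} {# 3} refl)
           2y (to-≢ E λ ()) (y≢1 ∘ sym) (y≢3 ∘ sym) (edge-sym simple wz)
  ...   | inj₁ refl        = contradiction xw (third-neighbour-off-saturated E third {# 1} refl)
  ...   | inj₂ (inj₁ refl) = contradiction xw (third-neighbour-off-saturated E third {# 3} refl)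
  ...   | inj₂ (inj₂ refl) = xw

  cap : Embedding rosette G → Fin n
  cap E = proj₁ (other-neighbour (to E (# 0)) (to E (# 1)) (to E (# 9)))

  cap-third : ∀ E → ThirdNeighbour E (cap E)
  cap-third E = proj₂ (other-neighbour (to E (# 0)) (to E (# 1)) (to E (# 9)))

  cap-adjacent : ∀ E → Edge G (cap E) (cap (E ∘ₑ rotationₑ))
  cap-adjacent E = third-neighbours-adjacent E (cap-third E) (cap-third (E ∘ₑ rotationₑ))

  cap-∉-image : ∀ E k j → cap (E ∘ₑ rotation k) ≢ to E j
  cap-∉-image E k j with i , refl ← rotation-surjective k j =
    third-neighbour-∉-image (E ∘ₑ rotation k) (cap-third (E ∘ₑ rotation k)) i

  -- If caps 0 and 2 coincided, caps 1, 3 and 4 would all be the unique neighbour of that vertex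
  -- off the rosette, but caps 3 and 4 are adjacent.
  cap-distinct : ∀ E → cap E ≢ cap (E ∘ₑ rotation 2)
  cap-distinct E cap₀≡cap₂ =
    edge⇒≢ simple (cap-adjacent (E ∘ₑ rotation 3)) (trans cap₃≡cap₁ (sym cap₄≡cap₁))
    where
    X : ℕ → Fin n
    X k = cap (E ∘ₑ rotation k)

    4X0 : Edge G (to E (# 4)) (X 0)
    4X0 = subst (Edge G (to E (# 4))) (sym cap₀≡cap₂) (proj₁ (cap-third (E ∘ₑ rotation 2)))

    off-rosette-neighbour : ∀ {w} → Edge G (X 0) w → (∀ j → w ≢ to E j) → w ≡ X 1
    off-rosette-neighbour 0w w∉E
      with cubic-neighbours cubic (edge-sym simple (proj₁ (cap-third E))) (edge-sym simple 4X0)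
             (cap-adjacent E) (to-≢ E λ ()) (cap-∉-image E 1 (# 0) ∘ sym) (cap-∉-image E 1 (# 4) ∘ sym) 0w
    ... | inj₁ refl        = contradiction refl (w∉E (# 0))
    ... | inj₂ (inj₁ refl) = contradiction refl (w∉E (# 4))
    ... | inj₂ (inj₂ w≡X1) = w≡X1

    cap₄≡cap₁ : X 4 ≡ X 1
    cap₄≡cap₁ = off-rosette-neighbour (edge-sym simple (cap-adjacent (E ∘ₑ rotation 4))) (cap-∉-image E 4)

    cap₃≡cap₁ : X 3 ≡ X 1
    cap₃≡cap₁ = off-rosette-neighbour
      (subst (λ v → Edge G v (X 3)) (sym cap₀≡cap₂) (cap-adjacent (E ∘ₑ rotation 2))) (cap-∉-image E 3)

  pentagonCap : Fin 5 → Fin n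
  pentagonCap k = cap (E₀ ∘ₑ rotation (toℕ k))

  pentagonCap-next : ∀ k → Edge G (pentagonCap k) (pentagonCap (next k))
  pentagonCap-next fzero                             = cap-adjacent (E₀ ∘ₑ rotation 0)
  pentagonCap-next (fsuc fzero)                      = cap-adjacent (E₀ ∘ₑ rotation 1)
  pentagonCap-next (fsuc (fsuc fzero))               = cap-adjacent (E₀ ∘ₑ rotation 2)
  pentagonCap-next (fsuc (fsuc (fsuc fzero)))        = cap-adjacent (E₀ ∘ₑ rotation 3)
  pentagonCap-next (fsuc (fsuc (fsuc (fsuc fzero)))) = cap-adjacent (E₀ ∘ₑ rotation 4)

  pentagonCap-far : ∀ k → pentagonCap k ≢ pentagonCap (next (next k))
  pentagonCap-far fzero                             = cap-distinct (E₀ ∘ₑ rotation 0)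
  pentagonCap-far (fsuc fzero)                      = cap-distinct (E₀ ∘ₑ rotation 1)
  pentagonCap-far (fsuc (fsuc fzero))               = cap-distinct (E₀ ∘ₑ rotation 2)
  pentagonCap-far (fsuc (fsuc (fsuc fzero)))        = cap-distinct (E₀ ∘ₑ rotation 3)
  pentagonCap-far (fsuc (fsuc (fsuc (fsuc fzero)))) = cap-distinct (E₀ ∘ₑ rotation 4)

  capped : Fin 5 ⊎ Fin 15 → Fin n
  capped = [ pentagonCap , to E₀ ]′

  capped-injective : Injective _≡_ _≡_ capped
  capped-injective {inj₁ _} {inj₁ _} e =
    cong inj₁ (injective-on-pentagon pentagonCap (edge⇒≢ simple ∘ pentagonCap-next) pentagonCap-far e)
  capped-injective {inj₁ k} {inj₂ j} e = contradiction e (cap-∉-image E₀ (toℕ k) j)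
  capped-injective {inj₂ j} {inj₁ k} e = contradiction (sym e) (cap-∉-image E₀ (toℕ k) j)
  capped-injective {inj₂ _} {inj₂ _} e = cong inj₂ (injective E₀ e)

  capped-edge : ∀ {c d} → CappedEdge c d → Edge G (capped c) (capped d)
  capped-edge {inj₁ k} {inj₁ _} (inj₁ refl) = pentagonCap-next k
  capped-edge {inj₁ _} {inj₁ l} (inj₂ refl) = edge-sym simple (pentagonCap-next l)
  capped-edge {inj₁ k} {inj₂ _} refl = edge-sym simple (proj₁ (cap-third (E₀ ∘ₑ rotation (toℕ k))))
  capped-edge {inj₂ _} {inj₁ k} refl = proj₁ (cap-third (E₀ ∘ₑ rotation (toℕ k)))
  capped-edge {inj₂ _} {inj₂ _} ij   = edge-preserving E₀ ij

  dodecahedron-embedding : Embedding dodecahedron G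
  dodecahedron-embedding = record
    { to              = capped ∘ splitAt 5
    ; injective       = Injection.injective (↔⇒↣ (+↔⊎ {5} {15})) ∘ capped-injective
    ; edge-preserving = λ {a} {b} ab → capped-edge (dodecahedron-capped a b ab)
    }

mainTheorem10 : ∀ (n : ℕ) (G : Graph n) →
    IsSimple G → Connected G → Cubic G → VertexTransitive G → HasGirth G 5 →
    UniformlyCyclically5EdgeConnected G →
    ContainsSubgraph G rosette →
    Isomorphic G dodecahedron
mainTheorem10 n G simple connected cubic vt girth _ (f , f-injective , f-edge) =
  embedding⇒isomorphic cubic connected dodecahedron-saturated
    (dodecahedron-embedding simple cubic girth vt rosette-in-G)
  where
  rosette-in-G : Embedding rosette G
  rosette-in-G = record { to = f ; injective = f-injective ; edge-preserving = f-edge _ _ }
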